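{- Let $c$ be a GCL command and $pc$ a variable not occurring in $c$. Then $\mathsf{ghost}(pc,\mathsf{add}^{pc}(c))$ holds, and $\mathsf{erase}(pc,\mathsf{add}^{pc}(c))\cong c$.
   Context: GCL commands: $c ::= \mathsf{skip}^n \mid x :=^n e \mid c;c \mid \mathsf{if}^n\, gcs\,\mathsf{fi} \mid \mathsf{do}^n\, gcs\,\mathsf{od}$, $gcs ::= e\to c \mid e\to c\,\square\,gcs$, with labels $n$, integer variables, boolean expressions built from primitive ones by $\wedge,\vee,\neg$; $\mathsf{enab}(gcs)$ is the disjunction of guards. $!n$ denotes the assignment $pc:=n$ (label irrelevant). $\mathsf{add}^{pc}$: $\mathsf{add}^{pc}(\mathsf{skip}^n)=!n;\mathsf{skip}^n$; $\mathsf{add}^{pc}(x:=^ne)=!n;x:=^ne$; $\mathsf{add}^{pc}(c;d)=\mathsf{add}^{pc}(c);\mathsf{add}^{pc}(d)$; $\mathsf{add}^{pc}(\mathsf{if}^n gcs\,\mathsf{fi})=!n;\mathsf{if}^n gcs_0\,\mathsf{fi}$ with each $e\to d$ replaced by $e\to\mathsf{add}^{pc}(d)$; $\mathsf{add}^{pc}(\mathsf{do}^n gcs\,\mathsf{od})=!n;\mathsf{do}^n gcs_1\,\mathsf{od}$ with each $e\to d$ replaced by $e\to\mathsf{add}^{pc}(d);!n$. $\mathsf{ghost}(x,c)$: $x$ occurs in $c$ only in assignments to $x$. $\mathsf{erase}(x,c)$: $c$ with every assignment $x:=^ne$ replaced by $\mathsf{skip}^n$ (recursively through all constructs). $c\cong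 d$ means $\mathrm{Hyp}\vdash\mathcal{K}(c)=\mathcal{K}(d)$, derivability in Kleene algebra with tests (KAT axioms: tests form a Boolean algebra, idempotent semiring, $1+x;x^*=x^*$, $1+x^*;x=x^*$, $y+x;z\le z\Rightarrow x^*;y\le z$, $y+z;x\le z\Rightarrow y;x^*\le z$) from hypotheses $\mathrm{Hyp}$, where $\mathcal{K}$ translates: $\mathcal{K}(b)=\underline{b}$ for primitive boolean $b$, $\mathcal{K}(e\wedge e')=\mathcal{K}(e);\mathcal{K}(e')$, $\mathcal{K}(e\vee e')=\mathcal{K}(e)+\mathcal{K}(e')$, $\mathcal{K}(\neg e)=\neg\mathcal{K}(e)$, $\mathcal{K}(x:=e)=\underline{x:=e}$, $\mathcal{K}(\mathsf{skip})=1$, $\mathcal{K}(c;d)=\mathcal{K}(c);\mathcal{K}(d)$, $\mathcal{K}(\mathsf{if}\,gcs\,\mathsf{fi})=\sum_{e\to c\in gcs}\mathcal{K}(e);\mathcal{K}(c)$, $\mathcal{K}(\mathsf{do}\,gcs\,\mathsf{od})=(\sum_{e\to c\in gcs}\mathcal{K}(e);\mathcal{K}(c))^*;\neg\mathcal{K}(\mathsf{enab}(gcs))$; and $\mathrm{Hyp}$ consists of $\mathcal{K}(e)=0$ for every boolean $e$ false in all stores and $\mathcal{K}(e_0);\underline{x:=e};\neg\mathcal{K}(e_1)=0$ whenever every store satisfying $e_0$ satisfies $e_1$ after assigning the value of $e$ to $x$. -}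

module Defs where

open import Data.Nat using (ℕ; _≡ᵇ_)
open import Data.Integer using (ℤ; +_) renaming (_+_ to _+ℤ_; _-_ to _-ℤ_; _*_ to _*ℤ_)
import Data.Integer as Int
open import Data.Bool using (Bool; true; false; _∧_; _∨_; not; if_then_else_)
open import Data.Product using (_×_)
open import Data.Unit using (⊤)
open import Relation.Nullary using (¬_)
open import Relation.Nullary.Decidable using (⌊_⌋)
open import Relation.Binary.PropositionalEquality using (_≡_)

Var : Set
Var = ℕ

Label : Set
Label = ℕ

data AExp : Set where
  var  : Var → AExp
  lit  : ℤ → AExp
  plus minus times : AExp → AExp → AExp

data PBool : Set where
  ptrue pfalse : PBool
  leq eq lt    : AExp → AExp → PBool

data BExp : Set where
  prim : PBool → BExp
  and  : BExp → BExp → BExp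
  or   : BExp → BExp → BExp
  neg  : BExp → BExp

mutual
  data Cmd : Set where
    skip   : Label → Cmd
    assign : Label → Var → AExp → Cmd
    seq    : Cmd → Cmd → Cmd
    ifc    : Label → GCs → Cmd
    doc    : Label → GCs → Cmd

  data GCs : Set where
    one  : BExp → Cmd → GCs
    cons : BExp → Cmd → GCs → GCs

enab : GCs → BExp
enab (one e c)    = e
enab (cons e c g) = or e (enab g)

Store : Set
Store = Var → ℤ

evalA : AExp → Store → ℤ
evalA (var x)       s = s x
evalA (lit n)       s = n
evalA (plus a b)    s = evalA a s +ℤ evalA b s
evalA (minus a b)   s = evalA a s -ℤ evalA b s
evalA (times a b)   s = evalA a s *ℤ evalA b s

evalP : PBool → Store → Bool
evalP ptrue     s = true
evalP pfalse    s = false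
evalP (leq a b) s = evalA a s Int.≤ᵇ evalA b s
evalP (eq a b)  s = ⌊ evalA a s Int.≟ evalA b s ⌋
evalP (lt a b)  s = not (evalA b s Int.≤ᵇ evalA a s)

evalB : BExp → Store → Bool
evalB (prim p)  s = evalP p s
evalB (and e f) s = evalB e s ∧ evalB f s
evalB (or e f)  s = evalB e s ∨ evalB f s
evalB (neg e)   s = not (evalB e s)

update : Store → Var → ℤ → Store
update s x v y = if y ≡ᵇ x then v else s y

notInA : Var → AExp → Set
notInA x (var y)     = ¬ (x ≡ y)
notInA x (lit n)     = ⊤
notInA x (plus a b)  = notInA x a × notInA x b
notInA x (minus a b) = notInA x a × notInA x b
notInA x (times a b) = notInA x a × notInA x b

notInP : Var → PBool → Set
notInP x ptrue     = ⊤
notInP x pfalse    = ⊤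
notInP x (leq a b) = notInA x a × notInA x b
notInP x (eq a b)  = notInA x a × notInA x b
notInP x (lt a b)  = notInA x a × notInA x b

notInB : Var → BExp → Set
notInB x (prim p)  = notInP x p
notInB x (and e f) = notInB x e × notInB x f
notInB x (or e f)  = notInB x e × notInB x f
notInB x (neg e)   = notInB x e

mutual
  notIn : Var → Cmd → Set
  notIn x (skip n)       = ⊤
  notIn x (assign n y e) = ¬ (x ≡ y) × notInA x e
  notIn x (seq c d)      = notIn x c × notIn x d
  notIn x (ifc n g)      = notInG x g
  notIn x (doc n g)      = notInG x g

  notInG : Var → GCs → Set
  notInG x (one e c)    = notInB x e × notIn x c
  notInG x (cons e c g) = notInB x e × notIn x c × notInG x g

mutual
  -- ghost(x,c): x occurs in c only in assignments to x
  -- (i.e. not in any guard, nor in any assignment to another variable)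
  ghost : Var → Cmd → Set
  ghost x (skip n)       = ⊤
  ghost x (assign n y e) = ¬ (x ≡ y) → notInA x e
  ghost x (seq c d)      = ghost x c × ghost x d
  ghost x (ifc n g)      = ghostG x g
  ghost x (doc n g)      = ghostG x g

  ghostG : Var → GCs → Set
  ghostG x (one e c)    = notInB x e × ghost x c
  ghostG x (cons e c g) = notInB x e × ghost x c × ghostG x g

-- !n  is  pc := n  (label irrelevant; we use label n)
setpc : Var → Label → Cmd
setpc pc n = assign n pc (lit (+ n))

mutual
  add : Var → Cmd → Cmd
  add pc (skip n)       = seq (setpc pc n) (skip n)
  add pc (assign n x e) = seq (setpc pc n) (assign n x e)
  add pc (seq c d)      = seq (add pc c) (add pc d)
  add pc (ifc n g)      = seq (setpc pc n) (ifc n (addIf pc g))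
  add pc (doc n g)      = seq (setpc pc n) (doc n (addDo pc n g))

  addIf : Var → GCs → GCs
  addIf pc (one e d)    = one e (add pc d)
  addIf pc (cons e d g) = cons e (add pc d) (addIf pc g)

  addDo : Var → Label → GCs → GCs
  addDo pc n (one e d)    = one e (seq (add pc d) (setpc pc n))
  addDo pc n (cons e d g) = cons e (seq (add pc d) (setpc pc n)) (addDo pc n g)

mutual
  erase : Var → Cmd → Cmd
  erase x (skip n)       = skip n
  erase x (assign n y e) = if x ≡ᵇ y then skip n else assign n y e
  erase x (seq c d)      = seq (erase x c) (erase x d)
  erase x (ifc n g)      = ifc n (eraseG x g)
  erase x (doc n g)      = doc n (eraseG x g)

  eraseG : Var → GCs → GCs
  eraseG x (one e c)    = one e (erase x c)
  eraseG x (cons e c g) = cons e (erase x c) (eraseG x g)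

data Test : Set where
  primT : PBool → Test
  ⊥t ⊤t : Test
  _∨t_ _∧t_ : Test → Test → Test
  ¬t_   : Test → Test

infixl 6 _⊕_
infixl 7 _⨾_
data KTerm : Set where
  tst : Test → KTerm
  act : Var → AExp → KTerm
  _⊕_ _⨾_ : KTerm → KTerm → KTerm
  _⋆ : KTerm → KTerm

𝟘 𝟙 : KTerm
𝟘 = tst ⊥t
𝟙 = tst ⊤t

KB : BExp → Test
KB (prim p)  = primT p
KB (and e f) = KB e ∧t KB f
KB (or e f)  = KB e ∨t KB f
KB (neg e)   = ¬t KB e

mutual
  K : Cmd → KTerm
  K (skip n)       = 𝟙
  K (assign n x e) = act x e
  K (seq c d)      = K c ⨾ K d
  K (ifc n g)      = KG g
  K (doc n g)      = (KG g) ⋆ ⨾ tst (¬t KB (enab g))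

  KG : GCs → KTerm
  KG (one e c)    = tst (KB e) ⨾ K c
  KG (cons e c g) = tst (KB e) ⨾ K c ⊕ KG g

infix 4 _≃_ _≲_
mutual
  _≲_ : KTerm → KTerm → Set
  p ≲ q = p ⊕ q ≃ q

  data _≃_ : KTerm → KTerm → Set where
    ≃-refl  : ∀ {p} → p ≃ p
    ≃-sym   : ∀ {p q} → p ≃ q → q ≃ p
    ≃-trans : ∀ {p q r} → p ≃ q → q ≃ r → p ≃ r
    ⊕-cong  : ∀ {p p' q q'} → p ≃ p' → q ≃ q' → p ⊕ q ≃ p' ⊕ q'
    ⨾-cong  : ∀ {p p' q q'} → p ≃ p' → q ≃ q' → p ⨾ q ≃ p' ⨾ q'
    ⋆-cong  : ∀ {p p'} → p ≃ p' → p ⋆ ≃ p' ⋆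
    ¬-cong  : ∀ {a b} → tst a ≃ tst b → tst (¬t a) ≃ tst (¬t b)
    ⊕-assoc : ∀ {p q r} → (p ⊕ q) ⊕ r ≃ p ⊕ (q ⊕ r)
    ⊕-comm  : ∀ {p q} → p ⊕ q ≃ q ⊕ p
    ⊕-zero  : ∀ {p} → p ⊕ 𝟘 ≃ p
    ⊕-idem  : ∀ {p} → p ⊕ p ≃ p
    ⨾-assoc : ∀ {p q r} → (p ⨾ q) ⨾ r ≃ p ⨾ (q ⨾ r)
    ⨾-idˡ   : ∀ {p} → 𝟙 ⨾ p ≃ p
    ⨾-idʳ   : ∀ {p} → p ⨾ 𝟙 ≃ p
    ⨾-zeroˡ : ∀ {p} → 𝟘 ⨾ p ≃ 𝟘
    ⨾-zeroʳ : ∀ {p} → p ⨾ 𝟘 ≃ 𝟘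
    distˡ   : ∀ {p q r} → p ⨾ (q ⊕ r) ≃ p ⨾ q ⊕ p ⨾ r
    distʳ   : ∀ {p q r} → (p ⊕ q) ⨾ r ≃ p ⨾ r ⊕ q ⨾ r
    unfoldˡ : ∀ {p} → 𝟙 ⊕ p ⨾ p ⋆ ≃ p ⋆
    unfoldʳ : ∀ {p} → 𝟙 ⊕ p ⋆ ⨾ p ≃ p ⋆
    inductˡ : ∀ {p q r} → q ⊕ p ⨾ r ≲ r → p ⋆ ⨾ q ≲ r
    inductʳ : ∀ {p q r} → q ⊕ r ⨾ p ≲ r → q ⨾ p ⋆ ≲ r
    tst-∨   : ∀ {a b} → tst (a ∨t b) ≃ tst a ⊕ tst b
    tst-∧   : ∀ {a b} → tst (a ∧t b) ≃ tst a ⨾ tst b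
    tst-comm : ∀ {a b} → tst a ⨾ tst b ≃ tst b ⨾ tst a
    tst-idem : ∀ {a} → tst a ⨾ tst a ≃ tst a
    tst-dist : ∀ {a b c} → tst a ⊕ tst b ⨾ tst c ≃ (tst a ⊕ tst b) ⨾ (tst a ⊕ tst c)
    tst-compl⊕ : ∀ {a} → tst a ⊕ tst (¬t a) ≃ 𝟙
    tst-compl⨾ : ∀ {a} → tst a ⨾ tst (¬t a) ≃ 𝟘
    hyp-false  : ∀ (e : BExp) → (∀ s → evalB e s ≡ false) → tst (KB e) ≃ 𝟘
    hyp-assign : ∀ (e₀ : BExp) (x : Var) (e : AExp) (e₁ : BExp) →
                 (∀ s → evalB e₀ s ≡ true → evalB e₁ (update s x (evalA e s)) ≡ true) →
                 tst (KB e₀) ⨾ act x e ⨾ tst (¬t KB e₁) ≃ 𝟘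

infix 4 _≅_
_≅_ : Cmd → Cmd → Set
c ≅ d = K c ≃ K d

-- The ghost property holds because add only inserts assignments to pc, and
-- a variable not occurring in c is trivially a ghost of c. For the erasure,
-- erasing pc from add pc c turns every inserted !n into skip, whose
-- translation 𝟙 is a unit in KAT; so it is equivalent to erase pc c, which
-- is c itself since pc does not occur in c.
module Submission where

open import Defs
open import Data.Bool using (true; false)
open import Data.Bool.Properties using (T-≡)
open import Data.Empty using (⊥-elim)
open import Data.Integer using (+_)
open import Data.Nat using (_≡ᵇ_)
open import Data.Nat.Properties using (≡ᵇ⇒≡; ≡⇒≡ᵇ)
open import Data.Product using (_×_; _,_)
open import Data.Unit using (tt)
open import Function.Bundles using (Equivalence)
open import Relation.Binary.PropositionalEquality using (_≡_; _≢_; refl; cong; cong₂; subst)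

⨾-identityˡ-≃ : ∀ {p q r} → p ≃ 𝟙 → q ≃ r → p ⨾ q ≃ r
⨾-identityˡ-≃ p≃𝟙 q≃r = ≃-trans (⨾-cong p≃𝟙 q≃r) ⨾-idˡ

⨾-identityʳ-≃ : ∀ {p q r} → q ≃ 𝟙 → p ≃ r → p ⨾ q ≃ r
⨾-identityʳ-≃ q≃𝟙 p≃r = ≃-trans (⨾-cong p≃r q≃𝟙) ⨾-idʳ

erase-assign-self : ∀ x n e → erase x (assign n x e) ≡ skip n
erase-assign-self x n e
  rewrite Equivalence.to T-≡ (≡⇒≡ᵇ x x refl) = refl

erase-assign-other : ∀ {x y} n e → x ≢ y → erase x (assign n y e) ≡ assign n y e
erase-assign-other {x} {y} n e x≢y with x ≡ᵇ y in x≡ᵇy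
... | true  = ⊥-elim (x≢y (≡ᵇ⇒≡ x y (Equivalence.from T-≡ x≡ᵇy)))
... | false = refl

erase-setpc : ∀ pc n → erase pc (setpc pc n) ≅ skip n
erase-setpc pc n rewrite erase-assign-self pc n (lit (+ n)) = ≃-refl

mutual
  notIn⇒ghost : ∀ x c → notIn x c → ghost x c
  notIn⇒ghost x (skip n)       _           = tt
  notIn⇒ghost x (assign n y e) (_ , x∉e)   = λ _ → x∉e
  notIn⇒ghost x (seq c d)      (x∉c , x∉d) = notIn⇒ghost x c x∉c , notIn⇒ghost x d x∉d
  notIn⇒ghost x (ifc n g)      x∉g         = notInG⇒ghostG x g x∉g
  notIn⇒ghost x (doc n g)      x∉g         = notInG⇒ghostG x g x∉g

  notInG⇒ghostG : ∀ x g → notInG x g → ghostG x g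
  notInG⇒ghostG x (one e c)    (x∉e , x∉c)       = x∉e , notIn⇒ghost x c x∉c
  notInG⇒ghostG x (cons e c g) (x∉e , x∉c , x∉g) =
    x∉e , notIn⇒ghost x c x∉c , notInG⇒ghostG x g x∉g

ghost-setpc : ∀ pc n → ghost pc (setpc pc n)
ghost-setpc pc n pc≢pc = ⊥-elim (pc≢pc refl)

mutual
  ghost-add : ∀ pc c → ghost pc c → ghost pc (add pc c)
  ghost-add pc (skip n)       _           = ghost-setpc pc n , tt
  ghost-add pc (assign n x e) gh          = ghost-setpc pc n , gh
  ghost-add pc (seq c d)      (ghc , ghd) = ghost-add pc c ghc , ghost-add pc d ghd
  ghost-add pc (ifc n g)      ghg         = ghost-setpc pc n , ghostG-addIf pc g ghg
  ghost-add pc (doc n g)      ghg         = ghost-setpc pc n , ghostG-addDo pc n g ghg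

  ghostG-addIf : ∀ pc g → ghostG pc g → ghostG pc (addIf pc g)
  ghostG-addIf pc (one e c)    (pc∉e , ghc)       = pc∉e , ghost-add pc c ghc
  ghostG-addIf pc (cons e c g) (pc∉e , ghc , ghg) =
    pc∉e , ghost-add pc c ghc , ghostG-addIf pc g ghg

  ghostG-addDo : ∀ pc n g → ghostG pc g → ghostG pc (addDo pc n g)
  ghostG-addDo pc n (one e c)    (pc∉e , ghc)       =
    pc∉e , ghost-add pc c ghc , ghost-setpc pc n
  ghostG-addDo pc n (cons e c g) (pc∉e , ghc , ghg) =
    pc∉e , (ghost-add pc c ghc , ghost-setpc pc n) , ghostG-addDo pc n g ghg

enab-eraseG : ∀ x g → enab (eraseG x g) ≡ enab g
enab-eraseG x (one e c)    = refl
enab-eraseG x (cons e c g) = cong (or e) (enab-eraseG x g)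

enab-addDo : ∀ pc n g → enab (addDo pc n g) ≡ enab g
enab-addDo pc n (one e c)    = refl
enab-addDo pc n (cons e c g) = cong (or e) (enab-addDo pc n g)

mutual
  erase-notIn : ∀ x c → notIn x c → erase x c ≡ c
  erase-notIn x (skip n)       _           = refl
  erase-notIn x (assign n y e) (x≢y , _)   = erase-assign-other n e x≢y
  erase-notIn x (seq c d)      (x∉c , x∉d) = cong₂ seq (erase-notIn x c x∉c) (erase-notIn x d x∉d)
  erase-notIn x (ifc n g)      x∉g         = cong (ifc n) (eraseG-notInG x g x∉g)
  erase-notIn x (doc n g)      x∉g         = cong (doc n) (eraseG-notInG x g x∉g)

  eraseG-notInG : ∀ x g → notInG x g → eraseG x g ≡ g
  eraseG-notInG x (one e c)    (_ , x∉c)       = cong (one e) (erase-notIn x c x∉c)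
  eraseG-notInG x (cons e c g) (_ , x∉c , x∉g) =
    cong₂ (cons e) (erase-notIn x c x∉c) (eraseG-notInG x g x∉g)

mutual
  erase-add : ∀ pc c → erase pc (add pc c) ≅ erase pc c
  erase-add pc (skip n)       = ⨾-identityˡ-≃ (erase-setpc pc n) ≃-refl
  erase-add pc (assign n x e) = ⨾-identityˡ-≃ (erase-setpc pc n) ≃-refl
  erase-add pc (seq c d)      = ⨾-cong (erase-add pc c) (erase-add pc d)
  erase-add pc (ifc n g)      = ⨾-identityˡ-≃ (erase-setpc pc n) (eraseG-addIf pc g)
  erase-add pc (doc n g)
    rewrite enab-eraseG pc (addDo pc n g) | enab-addDo pc n g | enab-eraseG pc g =
    ⨾-identityˡ-≃ (erase-setpc pc n) (⨾-cong (⋆-cong (eraseG-addDo pc n g)) ≃-refl)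

  eraseG-addIf : ∀ pc g → KG (eraseG pc (addIf pc g)) ≃ KG (eraseG pc g)
  eraseG-addIf pc (one e c)    = ⨾-cong ≃-refl (erase-add pc c)
  eraseG-addIf pc (cons e c g) = ⊕-cong (⨾-cong ≃-refl (erase-add pc c)) (eraseG-addIf pc g)

  eraseG-addDo : ∀ pc n g → KG (eraseG pc (addDo pc n g)) ≃ KG (eraseG pc g)
  eraseG-addDo pc n (one e c)    =
    ⨾-cong ≃-refl (⨾-identityʳ-≃ (erase-setpc pc n) (erase-add pc c))
  eraseG-addDo pc n (cons e c g) =
    ⊕-cong (⨾-cong ≃-refl (⨾-identityʳ-≃ (erase-setpc pc n) (erase-add pc c)))
           (eraseG-addDo pc n g)

lemma5p11 : (c : Cmd) (pc : Var) → notIn pc c →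
    ghost pc (add pc c) × (erase pc (add pc c) ≅ c)
lemma5p11 c pc pc∉c =
  ghost-add pc c (notIn⇒ghost pc c pc∉c) ,
  subst (erase pc (add pc c) ≅_) (erase-notIn pc c pc∉c) (erase-add pc c)
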